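{- Let $k \ge 2$ be an integer and let $G$ be a split graph with split partition $(X, Y)$, where $X$ is an independent set and $Y$ is a clique. If $\beta^k(G) \ge 1$, then $|Y| \ge \max\{k,\ |X| + k-1\}$.
   Context: All graphs are finite and simple. A split graph is a graph whose vertex set can be partitioned into $X$ (independent) and $Y$ (a clique); $(X,Y)$ is a split partition. For $S\subseteq V(G)$, $\Lambda^k_G(S)$ is the set of vertices with at least $k$ neighbors in $S$, and $\beta^k(G)=\min\{|\Lambda^k_G(S)|/|S| : S\subseteq V(G),\ |S|\ge k,\ \Lambda^k_G(S)\ne V(G)\}$, with $\beta^k(G)=0$ if $|V(G)|<k$. -}

module Defs where

open import Data.Nat using (ℕ; _≤_; _<_; _≤ᵇ_)
open import Data.Bool using (Bool; true; false)
open import Data.Fin using (Fin)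
open import Data.Fin.Subset using (Subset; _∈_; _∩_; ∣_∣; ⊤)
open import Data.Vec using (tabulate)
open import Data.Product using (_×_)
open import Data.Sum using (_⊎_)
open import Relation.Nullary using (¬_)
open import Relation.Binary.PropositionalEquality using (_≡_; _≢_)

record Graph (n : ℕ) : Set where
  field
    adj    : Fin n → Fin n → Bool
    sym    : ∀ u v → adj u v ≡ adj v u
    irrefl : ∀ v → adj v v ≡ false
open Graph public

N : ∀ {n} → Graph n → Fin n → Subset n
N G v = tabulate (adj G v)

Λ : ∀ {n} → ℕ → Graph n → Subset n → Subset n
Λ k G S = tabulate (λ v → k ≤ᵇ ∣ N G v ∩ S ∣)

Independent : ∀ {n} → Graph n → Subset n → Set
Independent G X = ∀ u v → u ∈ X → v ∈ X → adj G u v ≡ false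

Clique : ∀ {n} → Graph n → Subset n → Set
Clique G Y = ∀ u v → u ∈ Y → v ∈ Y → u ≢ v → adj G u v ≡ true

SplitPartition : ∀ {n} → Graph n → Subset n → Subset n → Set
SplitPartition G X Y =
  (∀ v → (v ∈ X ⊎ v ∈ Y) × ¬ (v ∈ X × v ∈ Y)) × Independent G X × Clique G Y

-- "β^k(G) ≥ 1".  β^k(G) = 0 when n < k (so the condition fails); otherwise
-- β^k(G) is the minimum of |Λ^k(S)|/|S| over the (nonempty, finite) family of
-- S with |S| ≥ k and Λ^k(S) ≠ V(G), so β^k(G) ≥ 1 iff every such ratio is ≥ 1.
BetaAtLeast1 : ∀ {n} → ℕ → Graph n → Set
BetaAtLeast1 {n} k G =
  k ≤ n × (∀ (S : Subset n) → k ≤ ∣ S ∣ → Λ k G S ≢ ⊤ → ∣ S ∣ ≤ ∣ Λ k G S ∣)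

{-# OPTIONS --safe #-}
-- Vertices of X have all their neighbours in Y, so whenever S meets Y in
-- fewer than k vertices, Λ^k(S) misses X and is contained in Y; if moreover
-- X ≠ ∅ then Λ^k(S) ≠ V(G), and β^k(G) ≥ 1 gives |S| ≤ |Λ^k(S)| ≤ |Y|.
-- Taking S = V(G) yields k ≤ |Y|, and taking S = X together with k - 1
-- vertices of Y yields |X| + k - 1 ≤ |Y|.
module Submission where

open import Defs hiding (sym)
open import Data.Nat using (ℕ; suc; _≤_; _<_; _+_; _∸_; _⊔_; z≤n; s≤s)
open import Data.Nat.Properties
  using ( ≤ᵇ⇒≤; ≤-refl; ≤-trans; ≤-<-trans; <-irrefl; <⇒≱; ≰⇒>; _≤?_; n≤1+n
        ; +-suc; +-monoˡ-≤; +-∸-assoc; ⊔-lub; module ≤-Reasoning)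
open import Data.Bool using (Bool; true; false)
open import Data.Bool.Properties using (T-≡; not-¬)
open import Data.Empty using (⊥-elim)
open import Data.Fin using (Fin; zero; suc)
open import Data.Fin.Subset
  using (Subset; ∣_∣; _∈_; _∉_; _∩_; _⊆_; ⊤; Nonempty)
open import Data.Fin.Subset.Properties
  using ( p⊆q⇒∣p∣≤∣q∣; ∣⊤∣≡n; ∣⊥∣≡0; ∈⊤; x∈p∩q⁺; x∈p∩q⁻; ∣p∩q∣≤∣p∣
        ; nonempty?; Empty-unique; x∈p⇒∣p-x∣<∣p∣)
open import Data.Vec using (_∷_; []; tabulate; here; there)
open import Data.Vec.Properties using ([]=⇒lookup; lookup∘tabulate)
open import Data.Product using (Σ-syntax; _×_; _,_; proj₁; proj₂)
open import Data.Sum using (inj₁; inj₂)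
open import Function using (Equivalence)
open import Relation.Nullary using (¬_; yes; no; contradiction)
open import Relation.Binary.PropositionalEquality
  using (_≡_; _≢_; refl; sym; trans; cong; subst)

∈-tabulate⁻ : ∀ {n} {f : Fin n → Bool} {v : Fin n} → v ∈ tabulate f → f v ≡ true
∈-tabulate⁻ {f = f} {v} v∈ = trans (sym (lookup∘tabulate f v)) ([]=⇒lookup v∈)

∈Λ⇒k≤∣N∩S∣ : ∀ {n k} (G : Graph n) (S : Subset n) {v : Fin n} →
             v ∈ Λ k G S → k ≤ ∣ N G v ∩ S ∣
∈Λ⇒k≤∣N∩S∣ {k = k} G S {v} v∈Λ =
  ≤ᵇ⇒≤ k ∣ N G v ∩ S ∣ (Equivalence.from T-≡ (∈-tabulate⁻ v∈Λ))

∩-monoˡ-⊆ : ∀ {n} {p q r : Subset n} → p ⊆ q → p ∩ r ⊆ q ∩ r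
∩-monoˡ-⊆ {p = p} {r = r} p⊆q x∈p∩r =
  let x∈p , x∈r = x∈p∩q⁻ p r x∈p∩r in x∈p∩q⁺ (p⊆q x∈p , x∈r)

Disjoint : ∀ {n} → Subset n → Subset n → Set
Disjoint X Y = ∀ v → ¬ (v ∈ X × v ∈ Y)

Disjoint-tail : ∀ {n} {x y : Bool} {X Y : Subset n} →
                Disjoint (x ∷ X) (y ∷ Y) → Disjoint X Y
Disjoint-tail disj v (v∈X , v∈Y) = disj (suc v) (there v∈X , there v∈Y)

extend-by-disjoint : ∀ {n} (X Y : Subset n) → Disjoint X Y → (m : ℕ) → m ≤ ∣ Y ∣ →
                     Σ[ S ∈ Subset n ] ∣ S ∣ ≡ ∣ X ∣ + m × ∣ Y ∩ S ∣ ≡ m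
extend-by-disjoint []          []          _    .0 z≤n = [] , refl , refl
extend-by-disjoint (true ∷ X)  (true ∷ Y)  disj m _ = ⊥-elim (disj zero (here , here))
extend-by-disjoint (true ∷ X)  (false ∷ Y) disj m m≤∣Y∣
  with S , ∣S∣≡ , ∣Y∩S∣≡ ← extend-by-disjoint X Y (Disjoint-tail disj) m m≤∣Y∣
  = true ∷ S , cong suc ∣S∣≡ , ∣Y∩S∣≡
extend-by-disjoint (false ∷ X) (true ∷ Y)  disj .0 z≤n
  with S , ∣S∣≡ , ∣Y∩S∣≡ ← extend-by-disjoint X Y (Disjoint-tail disj) 0 z≤n
  = false ∷ S , ∣S∣≡ , ∣Y∩S∣≡
extend-by-disjoint (false ∷ X) (true ∷ Y)  disj (suc m) (s≤s m≤∣Y∣)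
  with S , ∣S∣≡ , ∣Y∩S∣≡ ← extend-by-disjoint X Y (Disjoint-tail disj) m m≤∣Y∣
  = true ∷ S , trans (cong suc ∣S∣≡) (sym (+-suc ∣ X ∣ m)) , cong suc ∣Y∩S∣≡
extend-by-disjoint (false ∷ X) (false ∷ Y) disj m m≤∣Y∣
  with S , ∣S∣≡ , ∣Y∩S∣≡ ← extend-by-disjoint X Y (Disjoint-tail disj) m m≤∣Y∣
  = false ∷ S , ∣S∣≡ , ∣Y∩S∣≡

module _ {n : ℕ} (G : Graph n) {X Y : Subset n} (split : SplitPartition G X Y) where

  private
    disjoint : Disjoint X Y
    disjoint v = proj₂ (proj₁ split v)

    independent : Independent G X
    independent = proj₁ (proj₂ split)

  ∉X⇒∈Y : ∀ {v} → v ∉ X → v ∈ Y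
  ∉X⇒∈Y {v} v∉X with proj₁ (proj₁ split v)
  ... | inj₁ v∈X = contradiction v∈X v∉X
  ... | inj₂ v∈Y = v∈Y

  N⊆Y : ∀ {v} → v ∈ X → N G v ⊆ Y
  N⊆Y {v} v∈X {u} u∈N =
    ∉X⇒∈Y λ u∈X → not-¬ (independent v u v∈X u∈X) (∈-tabulate⁻ u∈N)

  X∩Λ-empty : ∀ {k S v} → ∣ Y ∩ S ∣ < k → v ∈ X → v ∉ Λ k G S
  X∩Λ-empty {S = S} ∣Y∩S∣<k v∈X v∈Λ =
    <⇒≱ ∣Y∩S∣<k (≤-trans (∈Λ⇒k≤∣N∩S∣ G S v∈Λ) (p⊆q⇒∣p∣≤∣q∣ (∩-monoˡ-⊆ (N⊆Y v∈X))))

  Λ⊆Y : ∀ {k S} → ∣ Y ∩ S ∣ < k → Λ k G S ⊆ Y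
  Λ⊆Y ∣Y∩S∣<k v∈Λ = ∉X⇒∈Y λ v∈X → X∩Λ-empty ∣Y∩S∣<k v∈X v∈Λ

  Λ≢⊤ : ∀ {k S} → Nonempty X → ∣ Y ∩ S ∣ < k → Λ k G S ≢ ⊤
  Λ≢⊤ (v , v∈X) ∣Y∩S∣<k Λ≡⊤ = X∩Λ-empty ∣Y∩S∣<k v∈X (subst (v ∈_) (sym Λ≡⊤) ∈⊤)

  ∣S∣≤∣Y∣ : ∀ {k S} → BetaAtLeast1 k G → Nonempty X →
            k ≤ ∣ S ∣ → ∣ Y ∩ S ∣ < k → ∣ S ∣ ≤ ∣ Y ∣
  ∣S∣≤∣Y∣ {S = S} (_ , β≥1) X≠∅ k≤∣S∣ ∣Y∩S∣<k =
    ≤-trans (β≥1 S k≤∣S∣ (Λ≢⊤ X≠∅ ∣Y∩S∣<k)) (p⊆q⇒∣p∣≤∣q∣ (Λ⊆Y ∣Y∩S∣<k))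

  k≤∣Y∣ : ∀ {k} → BetaAtLeast1 k G → k ≤ ∣ Y ∣
  k≤∣Y∣ {k} β@(k≤n , _) with nonempty? X
  ... | no X=∅ = begin
    k          ≤⟨ k≤n ⟩
    n          ≡⟨ sym (∣⊤∣≡n n) ⟩
    ∣ ⊤ {n} ∣  ≤⟨ p⊆q⇒∣p∣≤∣q∣ {p = ⊤} (λ {v} _ → ∉X⇒∈Y λ v∈X → X=∅ (v , v∈X)) ⟩
    ∣ Y ∣      ∎
    where open ≤-Reasoning
  ... | yes X≠∅ with k ≤? ∣ Y ∣
  ...   | yes k≤∣Y∣ = k≤∣Y∣
  ...   | no  k≰∣Y∣ = contradiction n<n (<-irrefl refl)
    where
    open ≤-Reasoning
    ∣Y∣<k : ∣ Y ∣ < k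
    ∣Y∣<k = ≰⇒> k≰∣Y∣
    ∣⊤∣≤∣Y∣ : ∣ ⊤ {n} ∣ ≤ ∣ Y ∣
    ∣⊤∣≤∣Y∣ = ∣S∣≤∣Y∣ β X≠∅ (subst (k ≤_) (sym (∣⊤∣≡n n)) k≤n)
                            (≤-<-trans (∣p∩q∣≤∣p∣ Y ⊤) ∣Y∣<k)
    n<n : n < n
    n<n = begin-strict
      n          ≡⟨ sym (∣⊤∣≡n n) ⟩
      ∣ ⊤ {n} ∣  ≤⟨ ∣⊤∣≤∣Y∣ ⟩
      ∣ Y ∣      <⟨ ∣Y∣<k ⟩
      k          ≤⟨ k≤n ⟩
      n          ∎

  ∣X∣+k∸1≤∣Y∣ : ∀ {k} → 1 ≤ k → BetaAtLeast1 k G → ∣ X ∣ + k ∸ 1 ≤ ∣ Y ∣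
  ∣X∣+k∸1≤∣Y∣ {suc j} _ β rewrite +-∸-assoc ∣ X ∣ {suc j} (s≤s z≤n) with nonempty? X
  ... | no X=∅ = begin
    ∣ X ∣ + j ≡⟨ cong (_+ j) (trans (cong ∣_∣ (Empty-unique X=∅)) (∣⊥∣≡0 n)) ⟩
    j         ≤⟨ n≤1+n j ⟩
    suc j     ≤⟨ k≤∣Y∣ β ⟩
    ∣ Y ∣     ∎
    where open ≤-Reasoning
  ... | yes X≠∅
    with S , ∣S∣≡∣X∣+j , ∣Y∩S∣≡j ←
           extend-by-disjoint X Y disjoint j (≤-trans (n≤1+n j) (k≤∣Y∣ β))
    = subst (_≤ ∣ Y ∣) ∣S∣≡∣X∣+j (∣S∣≤∣Y∣ β X≠∅ k≤∣S∣ ∣Y∩S∣<k)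
    where
    k≤∣S∣ : suc j ≤ ∣ S ∣
    k≤∣S∣ = subst (suc j ≤_) (sym ∣S∣≡∣X∣+j) (+-monoˡ-≤ j 0<∣X∣)
      where
      0<∣X∣ : 0 < ∣ X ∣
      0<∣X∣ = ≤-<-trans z≤n (x∈p⇒∣p-x∣<∣p∣ (proj₂ X≠∅))
    ∣Y∩S∣<k : ∣ Y ∩ S ∣ < suc j
    ∣Y∩S∣<k = subst (_< suc j) (sym ∣Y∩S∣≡j) ≤-refl

mainTheorem19 : (k n : ℕ) → 2 ≤ k → (G : Graph n) → (X Y : Subset n) →
    SplitPartition G X Y → BetaAtLeast1 k G →
    k ⊔ (∣ X ∣ + k ∸ 1) ≤ ∣ Y ∣
mainTheorem19 k n 2≤k G X Y split β =
  ⊔-lub (k≤∣Y∣ G split β) (∣X∣+k∸1≤∣Y∣ G split (≤-trans (s≤s z≤n) 2≤k) β)
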